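{- $N^1(BA_2^+)=\Omega(n)$.
   Context: $BA_2^+$ denotes the syntactic ordered monoid of the regular language $(ab)^*$ over $\{a,b\}$ (the language recognized by the minimal automaton with states $1,2,0$, initial and accepting state $1$, transitions $1\xrightarrow{a}2$, $2\xrightarrow{b}1$, $1\xrightarrow{b}0$, $2\xrightarrow{a}0$, and $0$ a sink). The syntactic ordered monoid of $L\subseteq\Sigma^*$: $x\preceq_L y$ iff for all $u,v$, $uyv\in L\Rightarrow uxv\in L$; it is $\Sigma^*/\equiv_L$ (with $x\equiv_L y$ iff $x\preceq_L y$ and $y\preceq_L x$) ordered by $[x]\leq[y]$ iff $x\preceq_L y$. For a finite ordered monoid $M$ (monoid with stable partial order) and order ideal $I$ (downward closed subset), the evaluation problem $(M,I)$ of length $n$: Alice receives $m_1,m_3,\dots,m_{2n-1}$, Bob receives $m_2,\dots,m_{2n}$, output $1$ iff $m_1\cdots m_{2n}\in I$. $N^1(M)$ is the maximum over $I$ of the non-deterministic communication complexity of $(M,I)$ as a function of $n$ (minimum over protocols with a common proof string $s$, accepting $1$-inputs for some $s$ and $0$-inputs for no $s$, of the maximum over $1$-inputs of the minimum over accepting $s$ of $|s|$ plus bits communicated). -}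

module Defs where

open import Data.Nat using (ℕ; _+_; _*_; _≤_)
open import Data.Bool using (Bool; true; false)
open import Data.List using (List; []; _∷_; _++_; length; concat)
open import Data.Vec using (Vec; toList; zipWith)
open import Data.Product using (Σ; ∃; _×_; _,_)
open import Function.Bundles using (_⇔_)
open import Relation.Binary.PropositionalEquality using (_≡_)

-- The language (ab)* via its minimal automaton

data Letter : Set where
  a b : Letter

data State : Set where
  s1 s2 s0 : State

δ : State → Letter → State
δ s1 a = s2
δ s2 b = s1
δ s1 b = s0
δ s2 a = s0
δ s0 _ = s0

δ* : State → List Letter → State
δ* q []       = q
δ* q (c ∷ w) = δ* (δ q c) w

L : List Letter → Set
L w = δ* s1 w ≡ s1

-- The syntactic ordered monoid BA₂⁺ = Σ*/≡_L, represented by words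
-- (representatives), multiplication = concatenation, order = ⪯_L.

_⪯_ : List Letter → List Letter → Set
x ⪯ y = ∀ (u v : List Letter) → L (u ++ y ++ v) → L (u ++ x ++ v)

IsOrderIdeal : (List Letter → Set) → Set
IsOrderIdeal I = ∀ x y → x ⪯ y → I y → I x

-- m₁ m₂ m₃ ⋯ m₂ₙ where Alice holds m₁,m₃,… and Bob holds m₂,m₄,…
interleaveProduct : ∀ {n} → Vec (List Letter) n → Vec (List Letter) n → List Letter
interleaveProduct xs ys = concat (toList (zipWith _++_ xs ys))

data Protocol (X Y : Set) : Set where
  leaf  : Bool → Protocol X Y
  alice : (X → Bool) → Protocol X Y → Protocol X Y → Protocol X Y
  bob   : (Y → Bool) → Protocol X Y → Protocol X Y → Protocol X Y

module _ {X Y : Set} where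
  branch : {Z : Set} → Bool → Z → Z → Z
  branch true  p q = p
  branch false p q = q

  output : Protocol X Y → X → Y → Bool
  output-br : Bool → Protocol X Y → Protocol X Y → X → Y → Bool
  output (leaf o)      x y = o
  output (alice f p q) x y = output-br (f x) p q x y
  output (bob g p q)   x y = output-br (g y) p q x y
  output-br true  p q x y = output p x y
  output-br false p q x y = output q x y

  bits : Protocol X Y → X → Y → ℕ
  bits-br : Bool → Protocol X Y → Protocol X Y → X → Y → ℕ
  bits (leaf o)      x y = 0
  bits (alice f p q) x y = 1 + bits-br (f x) p q x y
  bits (bob g p q)   x y = 1 + bits-br (g y) p q x y
  bits-br true  p q x y = bits p x y
  bits-br false p q x y = bits q x y

-- A nondeterministic protocol: for every common proof string s a
-- deterministic protocol.
NProtocol : Set → Set → Set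
NProtocol X Y = List Bool → Protocol X Y

NComputes : {X Y : Set} → NProtocol X Y → (X → Y → Set) → Set
NComputes {X} {Y} P F = ∀ (x : X) (y : Y) → F x y ⇔ (∃ λ s → output (P s) x y ≡ true)

NCostAtMost : {X Y : Set} → NProtocol X Y → (X → Y → Set) → ℕ → Set
NCostAtMost {X} {Y} P F C = ∀ (x : X) (y : Y) → F x y →
  ∃ λ s → (output (P s) x y ≡ true) × (length s + bits (P s) x y ≤ C)

EvalProblem : (n : ℕ) → (List Letter → Set) →
              Vec (List Letter) n → Vec (List Letter) n → Set
EvalProblem n I xs ys = I (interleaveProduct xs ys)

N1AtLeast : ℕ → ℕ → Set₁
N1AtLeast n D = Σ (List Letter → Set) λ I → IsOrderIdeal I ×
  (∀ (P : NProtocol (Vec (List Letter) n) (Vec (List Letter) n)) (C : ℕ) →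
     NComputes P (EvalProblem n I) → NCostAtMost P (EvalProblem n I) C → D ≤ C)

-- The words a^{v₁} b^{v₁} ⋯ a^{vₙ} b^{vₙ} (v ∈ {0,1}ⁿ), with Alice holding the a-blocks and Bob
-- the b-blocks, form a fooling set of size 2ⁿ for the ideal (ab)*: every such word lies in (ab)*,
-- while for v ≠ w one of the two crossed products runs into the sink state at the first position
-- where v and w differ.  In a nondeterministic protocol an accepting proof string together with the
-- transcript of its run is a certificate, and by the rectangle property two inputs sharing a
-- certificate force both crossed inputs to be accepted.  So certificates of cost C, which fit into
-- 2C + 2 bits, separate 2ⁿ inputs, and n ≤ 2C + 2.

module Submission where

open import Defs
open import Data.Nat using (ℕ; _*_; _≤_; _≥_; suc)
open import Data.Product using (Σ; _×_)

open import Data.Bool using (Bool; true; false)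
open import Data.Empty using (⊥-elim)
open import Data.Fin using (Fin; combine; quotient; remainder)
import Data.Fin as Fin
open import Data.Fin.Properties
  using (2↔Bool; remQuot-combine; combine-remQuot; injective⇒≤)
open import Data.List using (List; []; _∷_; length)
import Data.List.Properties as List
open import Data.Nat using (zero; _+_; _^_; _<_; z≤n; s≤s)
open import Data.Nat.Properties
  using (≤-trans; ≮⇒≥; <⇒≱; +-mono-≤; +-suc; *-suc; m+n≤o⇒m≤o; m+n≤o⇒n≤o; m≤n+m; ^-monoʳ-<)
open import Data.Product using (_,_; proj₁; proj₂; uncurry)
open import Data.Vec using (Vec; []; _∷_; map; replicate)
import Data.Vec as Vec
open import Data.Vec.Properties using (∷-injective; ∷-injectiveʳ; ++-injective)
open import Function.Bundles
  using (Equivalence; Inverse; Injection; _↔_; _↣_; mk↔ₛ′; mk↣)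
open import Function.Construct.Composition using (_↣-∘_)
open import Function using (_∘_)
open import Function.Definitions using (Injective)
open import Function.Properties.Inverse using (↔-sym; ↔⇒↣)
open import Relation.Binary.PropositionalEquality
  using (_≡_; _≢_; refl; sym; trans; cong; cong₂; subst)


δ*-s0 : ∀ w → δ* s0 w ≡ s0
δ*-s0 []      = refl
δ*-s0 (_ ∷ w) = δ*-s0 w

s0-rejects : ∀ w → δ* s0 w ≢ s1
s0-rejects w eq with trans (sym (δ*-s0 w)) eq
... | ()

L-isOrderIdeal : IsOrderIdeal L
L-isOrderIdeal x y x⪯y y∈L =
  subst L (List.++-identityʳ x) (x⪯y [] [] (subst L (sym (List.++-identityʳ y)) y∈L))

a^_ b^_ : Bool → List Letter
a^ true  = a ∷ []
a^ false = []
b^ true  = b ∷ []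
b^ false = []

interleave-bits : ∀ {n} → Vec Bool n → Vec Bool n → List Letter
interleave-bits v w = interleaveProduct (map a^_ v) (map b^_ w)

interleave-bits-diagonal : ∀ {n} (v : Vec Bool n) → L (interleave-bits v v)
interleave-bits-diagonal []          = refl
interleave-bits-diagonal (true ∷ v)  = interleave-bits-diagonal v
interleave-bits-diagonal (false ∷ v) = interleave-bits-diagonal v

interleave-bits-crossed : ∀ {n} (v w : Vec Bool n) →
  L (interleave-bits v w) → L (interleave-bits w v) → v ≡ w
interleave-bits-crossed []          []          _ _ = refl
interleave-bits-crossed (true ∷ v)  (true ∷ w)  p q = cong (true ∷_) (interleave-bits-crossed v w p q)
interleave-bits-crossed (false ∷ v) (false ∷ w) p q = cong (false ∷_) (interleave-bits-crossed v w p q)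
interleave-bits-crossed (true ∷ v)  (false ∷ w) _ q = ⊥-elim (s0-rejects (interleave-bits w v) q)
interleave-bits-crossed (false ∷ v) (true ∷ w)  p _ = ⊥-elim (s0-rejects (interleave-bits v w) p)


module _ {X Y : Set} where

  transcript : Protocol X Y → X → Y → List Bool
  transcript-br : Bool → Protocol X Y → Protocol X Y → X → Y → List Bool
  transcript (leaf _)      x y = []
  transcript (alice f p q) x y = f x ∷ transcript-br (f x) p q x y
  transcript (bob g p q)   x y = g y ∷ transcript-br (g y) p q x y
  transcript-br true  p q x y = transcript p x y
  transcript-br false p q x y = transcript q x y

  length-transcript : ∀ p x y → length (transcript p x y) ≡ bits p x y
  length-transcript (leaf _) x y = refl
  length-transcript (alice f p q) x y with f x
  ... | true  = cong suc (length-transcript p x y)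
  ... | false = cong suc (length-transcript q x y)
  length-transcript (bob g p q) x y with g y
  ... | true  = cong suc (length-transcript p x y)
  ... | false = cong suc (length-transcript q x y)

  output-rectangle : ∀ p {x y x′ y′} →
    transcript p x y ≡ transcript p x′ y′ → output p x y′ ≡ output p x y
  output-rectangle (leaf _) _ = refl
  output-rectangle (alice f p q) {x} {x′ = x′} e with f x | f x′ | e
  ... | true  | true  | e′ = output-rectangle p (List.∷-injectiveʳ e′)
  ... | false | false | e′ = output-rectangle q (List.∷-injectiveʳ e′)
  output-rectangle (bob g p q) {y = y} {y′ = y′} e with g y | g y′ | e
  ... | true  | true  | e′ = output-rectangle p (List.∷-injectiveʳ e′)
  ... | false | false | e′ = output-rectangle q (List.∷-injectiveʳ e′)

  module _ (P : NProtocol X Y) {F : X → Y → Set} (P-computes : NComputes P F) where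

    shared-transcript⇒crossed : ∀ s {x y x′ y′} → output (P s) x y ≡ true →
      transcript (P s) x y ≡ transcript (P s) x′ y′ → F x y′
    shared-transcript⇒crossed s accepts same =
      Equivalence.from (P-computes _ _) (s , trans (output-rectangle (P s) same) accepts)

    shared-certificate⇒crossed : ∀ {s s′ x y x′ y′} →
      output (P s) x y ≡ true → output (P s′) x′ y′ ≡ true →
      s ≡ s′ → transcript (P s) x y ≡ transcript (P s′) x′ y′ → F x y′ × F x′ y
    shared-certificate⇒crossed {s} accepts accepts′ refl same =
      shared-transcript⇒crossed s accepts same , shared-transcript⇒crossed s accepts′ (sym same)


bits↔Fin : ∀ k → Vec Bool k ↔ Fin (2 ^ k)
bits↔Fin k = mk↔ₛ′ toFin fromFin (toFin∘fromFin {k}) fromFin∘toFin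
  where
  open Inverse 2↔Bool using (to; from; strictlyInverseˡ; strictlyInverseʳ)

  toFin : ∀ {k} → Vec Bool k → Fin (2 ^ k)
  toFin []      = Fin.zero
  toFin (c ∷ v) = combine (from c) (toFin v)

  fromFin : ∀ {k} → Fin (2 ^ k) → Vec Bool k
  fromFin {zero}  _ = []
  fromFin {suc k} i = to (quotient (2 ^ k) i) ∷ fromFin (remainder {2} (2 ^ k) i)

  toFin∘fromFin : ∀ {k} (i : Fin (2 ^ k)) → toFin (fromFin {k} i) ≡ i
  toFin∘fromFin {zero}  Fin.zero = refl
  toFin∘fromFin {suc k} i =
    trans (cong₂ combine (strictlyInverseʳ (quotient (2 ^ k) i))
                         (toFin∘fromFin {k} (remainder {2} (2 ^ k) i)))
          (combine-remQuot {2} (2 ^ k) i)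

  fromFin∘toFin : ∀ {k} (v : Vec Bool k) → fromFin (toFin v) ≡ v
  fromFin∘toFin []      = refl
  fromFin∘toFin (c ∷ v) = cong₂ _∷_
    (trans (cong (to ∘ proj₁) (remQuot-combine (from c) (toFin v))) (strictlyInverseˡ c))
    (trans (cong (fromFin ∘ proj₂) (remQuot-combine (from c) (toFin v))) (fromFin∘toFin v))

bits-injection⇒≤ : ∀ {m n} → Vec Bool m ↣ Vec Bool n → m ≤ n
bits-injection⇒≤ {m} {n} f = ≮⇒≥ λ n<m →
  <⇒≱ (^-monoʳ-< 2 (s≤s (s≤s z≤n)) n<m) (injective⇒≤ (Injection.injective fin-injection))
  where
  fin-injection : Fin (2 ^ m) ↣ Fin (2 ^ n)
  fin-injection = ↔⇒↣ (bits↔Fin n) ↣-∘ (f ↣-∘ ↔⇒↣ (↔-sym (bits↔Fin m)))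

-- l, then the end marker true, then falses; l itself is truncated if it is longer than m.
pad : (m : ℕ) → List Bool → Vec Bool (suc m)
pad zero    _       = true ∷ []
pad (suc m) []      = true ∷ replicate (suc m) false
pad (suc m) (c ∷ l) = c ∷ pad m l

pad≢falses : ∀ m l → pad m l ≢ replicate (suc m) false
pad≢falses (suc m) (c ∷ l) eq = pad≢falses m l (∷-injectiveʳ eq)

pad-injective : ∀ m {l l′} → length l ≤ m → length l′ ≤ m → pad m l ≡ pad m l′ → l ≡ l′
pad-injective zero    {[]}    {[]}     _       _        _  = refl
pad-injective (suc m) {[]}    {[]}     _       _        _  = refl
pad-injective (suc m) {[]}    {_ ∷ l′} _       _        eq = ⊥-elim (pad≢falses m l′ (sym (∷-injectiveʳ eq)))
pad-injective (suc m) {_ ∷ l} {[]}     _       _        eq = ⊥-elim (pad≢falses m l (∷-injectiveʳ eq))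
pad-injective (suc m) {_ ∷ l} {_ ∷ l′} (s≤s p) (s≤s p′) eq with ∷-injective eq
... | refl , pads≡ = cong (_ ∷_) (pad-injective m p p′ pads≡)


record FoolingSet {X Y : Set} (A : Set) (F : X → Y → Set) : Set where
  field
    aliceInput : A → X
    bobInput   : A → Y
    diagonal   : ∀ v → F (aliceInput v) (bobInput v)
    crossed    : ∀ v w → F (aliceInput v) (bobInput w) → F (aliceInput w) (bobInput v) → v ≡ w

module _ {X Y A : Set} {F : X → Y → Set} (S : FoolingSet A F)
         (P : NProtocol X Y) (P-computes : NComputes P F) where
  open FoolingSet S

  certificate-injection : ∀ {C} → NCostAtMost P F C → A ↣ Vec Bool (suc C + suc C)
  certificate-injection {C} cost = mk↣ {to = code} code-injective
    where
    proof : A → List Bool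
    proof v = proj₁ (cost _ _ (diagonal v))

    run : A → List Bool
    run v = transcript (P (proof v)) (aliceInput v) (bobInput v)

    accepts : ∀ v → output (P (proof v)) (aliceInput v) (bobInput v) ≡ true
    accepts v = proj₁ (proj₂ (cost _ _ (diagonal v)))

    cheap : ∀ v → length (proof v) + length (run v) ≤ C
    cheap v = subst (λ r → length (proof v) + r ≤ C)
                    (sym (length-transcript (P (proof v)) (aliceInput v) (bobInput v)))
                    (proj₂ (proj₂ (cost _ _ (diagonal v))))

    code : A → Vec Bool (suc C + suc C)
    code v = pad C (proof v) Vec.++ pad C (run v)

    code-injective : Injective _≡_ _≡_ code
    code-injective {v} {w} eq = uncurry (crossed v w)
      (shared-certificate⇒crossed P P-computes (accepts v) (accepts w) same-proof same-run)
      where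
      same-pads : pad C (proof v) ≡ pad C (proof w) × pad C (run v) ≡ pad C (run w)
      same-pads = ++-injective (pad C (proof v)) (pad C (proof w)) eq
      same-proof : proof v ≡ proof w
      same-proof = pad-injective C (m+n≤o⇒m≤o _ (cheap v)) (m+n≤o⇒m≤o _ (cheap w)) (proj₁ same-pads)
      same-run : run v ≡ run w
      same-run = pad-injective C (m+n≤o⇒n≤o _ (cheap v)) (m+n≤o⇒n≤o _ (cheap w)) (proj₂ same-pads)

foolingSet-bound : ∀ {X Y : Set} {F : X → Y → Set} {n C} → FoolingSet (Vec Bool n) F →
  (P : NProtocol X Y) → NComputes P F → NCostAtMost P F C → n ≤ suc C + suc C
foolingSet-bound S P P-computes cost = bits-injection⇒≤ (certificate-injection S P P-computes cost)


L-foolingSet : ∀ n → FoolingSet (Vec Bool n) (EvalProblem n L)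
L-foolingSet n = record
  { aliceInput = map a^_
  ; bobInput   = map b^_
  ; diagonal   = interleave-bits-diagonal
  ; crossed    = interleave-bits-crossed
  }

N1AtLeast-L : ∀ {n D} → D + D < n → N1AtLeast n D
N1AtLeast-L {n} {D} D+D<n = L , L-isOrderIdeal , D≤cost
  where
  D≤cost : ∀ P C → NComputes P (EvalProblem n L) → NCostAtMost P (EvalProblem n L) C → D ≤ C
  D≤cost P C P-computes cost = ≮⇒≥ λ C<D →
    <⇒≱ D+D<n (≤-trans (foolingSet-bound (L-foolingSet n) P P-computes cost) (+-mono-≤ C<D C<D))

D+D<n≤4*D : ∀ n → 3 ≤ n → Σ ℕ λ D → D + D < n × n ≤ 4 * D
D+D<n≤4*D 1 (s≤s ())
D+D<n≤4*D 2 (s≤s (s≤s ()))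
D+D<n≤4*D 3 _ = 1 , s≤s (s≤s (s≤s z≤n)) , s≤s (s≤s (s≤s z≤n))
D+D<n≤4*D 4 _ = 1 , s≤s (s≤s (s≤s z≤n)) , s≤s (s≤s (s≤s (s≤s z≤n)))
D+D<n≤4*D (suc (suc n@(suc (suc (suc _))))) _ with D+D<n≤4*D n (s≤s (s≤s (s≤s z≤n)))
... | D , D+D<n , n≤4D = suc D , D+D<n+2 , n+2≤4D+4
  where
  D+D<n+2 : suc D + suc D < suc (suc n)
  D+D<n+2 rewrite +-suc D D = s≤s (s≤s D+D<n)
  n+2≤4D+4 : suc (suc n) ≤ 4 * suc D
  n+2≤4D+4 rewrite *-suc 4 D = s≤s (s≤s (≤-trans n≤4D (m≤n+m (4 * D) 2)))

corollary4p13 : Σ ℕ λ k → Σ ℕ λ n₀ → ∀ (n : ℕ) → n ≥ n₀ →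
    Σ ℕ λ D → N1AtLeast n D × n ≤ suc k * D
corollary4p13 = 3 , 3 , λ n 3≤n →
  let D , D+D<n , n≤4D = D+D<n≤4*D n 3≤n in D , N1AtLeast-L D+D<n , n≤4D
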